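{- If $X\subseteq A\cup B\cup\{a,b\}$ spans $p$ but not $q$ in $M_2(L,p,q;N,A,B)$, then $X=A\cup\{a\}$.
   Context: Let $L$ and $N$ be matroids with disjoint ground sets, let $(A,B)$ be a partition of $E(N)$ into two bases of $N$, and let $p$ and $q$ be distinct elements of $L$. For a flat $F$ of a matroid $M$, "freely placing" a new element $e$ in $F$ means forming the principal extension $M'$ on $E(M)\cup\{e\}$ with $M'\setminus e=M$ in which a subset of $E(M)$ spans $e$ if and only if it spans $F$ (freely placing $e$ in a set means freely placing it in the flat spanned by that set). Build $M_1(L,p,q;N,A,B)$ from $N\oplus L$ by freely placing new elements $a$ and $b$ in the flats spanned by $E(N)\cup\{p\}$ and $E(N)\cup\{q\}$ respectively; then, for each $x\in A$, freely place a new element $x_a$ in the flat spanned by $\{x,a\}$, and for each $y\in B$, freely place a new element $y_b$ in the flat spanned by $\{y,b\}$. Obtain $M_2(L,p,q;N,A,B)$ from $M_1(L,p,q;N,A,B)$ by deleting every $x\in A$ and every $y\in B$ and relabelling each $x_a$ as $x$ and each $y_b$ as $y$. -}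

module Defs where

open import Data.Bool using (Bool; true; false; _∨_; _∧_; not; if_then_else_; T)
open import Data.Nat using (ℕ; suc; _+_; _≤_; _≡ᵇ_)
open import Data.List using (List; length; filterᵇ; foldl)
open import Data.List.Membership.Propositional using (_∈_)
open import Data.List.Relation.Unary.Unique.Propositional using (Unique)
open import Data.Sum using (_⊎_; inj₁; inj₂)
open import Data.Sum.Properties using (≡-dec)
open import Data.Product using (_×_)
open import Relation.Binary.PropositionalEquality using (_≡_; refl)
open import Relation.Binary.Definitions using (DecidableEquality)
open import Relation.Nullary.Decidable using (does; yes; no)

Subset : Set → Set
Subset E = E → Bool

module _ {E : Set} where
  _∪_ : Subset E → Subset E → Subset E
  (X ∪ Y) e = X e ∨ Y e

  _∩_ : Subset E → Subset E → Subset E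
  (X ∩ Y) e = X e ∧ Y e

  _⊆_ : Subset E → Subset E → Set
  X ⊆ Y = ∀ e → T (X e) → T (Y e)

  full : Subset E
  full _ = true

  remove : DecidableEquality E → Subset E → E → Subset E
  remove _≟_ X e x = if does (x ≟ e) then false else X x

  single : DecidableEquality E → E → Subset E
  single _≟_ e x = does (x ≟ e)

  infixr 6 _∪_
  infixr 7 _∩_

record FinSet (E : Set) : Set where
  field
    _≟_      : DecidableEquality E
    elems    : List E
    complete : ∀ x → x ∈ elems
    unique   : Unique elems

open FinSet public

size : {E : Set} → FinSet E → Subset E → ℕ
size F X = length (filterᵇ X (elems F))

RankFn : Set → Set
RankFn E = Subset E → ℕ

record IsMatroid {E : Set} (F : FinSet E) (r : RankFn E) : Set where
  field
    r-ext    : ∀ X Y → (∀ e → X e ≡ Y e) → r X ≡ r Y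
    r-bound  : ∀ X → r X ≤ size F X
    r-mono   : ∀ X Y → X ⊆ Y → r X ≤ r Y
    r-submod : ∀ X Y → r (X ∪ Y) + r (X ∩ Y) ≤ r X + r Y

Spans : {E : Set} → RankFn E → Subset E → Subset E → Set
Spans r X Y = r (X ∪ Y) ≡ r X

SpansElt : {E : Set} → DecidableEquality E → RankFn E → Subset E → E → Set
SpansElt _≟_ r X e = Spans r X (single _≟_ e)

IsBasis : {E : Set} → FinSet E → RankFn E → Subset E → Set
IsBasis F r B = (r B ≡ size F B) × (r B ≡ r full)

-- Freely placing a new element e in the flat spanned by S
-- (principal extension).  The rank function lives on a fixed ambient type
-- G; the element e is regarded as new, i.e. the old rank function r is
-- only consulted on sets not containing e.

freelyPlace : {G : Set} → DecidableEquality G → RankFn G → G → Subset G → RankFn G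
freelyPlace _≟_ r e S X =
  if X e
  then (let X' = remove _≟_ X e in
        if r (X' ∪ S) ≡ᵇ r X' then r X' else suc (r X'))
  else r X

data AB : Set where
  ea eb : AB

_≟AB_ : DecidableEquality AB
ea ≟AB ea = yes refl
ea ≟AB eb = no (λ ())
eb ≟AB ea = no (λ ())
eb ≟AB eb = yes refl

-- Ground type of M₁:  E(N) ⊎ E(L) ⊎ {a,b} ⊎ {x_a, y_b : x ∈ A, y ∈ B}
-- (the last summand is a copy of E(N): copy x is x_a if x ∈ A, x_b if x ∈ B)
G₁ : Set → Set → Set
G₁ EN EL = EN ⊎ (EL ⊎ (AB ⊎ EN))

-- Ground type of M₂:  A ∪ B (the relabelled copies) ⊎ E(L) ⊎ {a,b}
G₂ : Set → Set → Set
G₂ EN EL = EN ⊎ (EL ⊎ AB)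

module Construction {EN EL : Set} (FN : FinSet EN) (FL : FinSet EL)
                    (rN : RankFn EN) (rL : RankFn EL)
                    (inA : Subset EN)   -- A = inA, B = complement of A
                    (p q : EL) where

  _≟₁_ : DecidableEquality (G₁ EN EL)
  _≟₁_ = ≡-dec (_≟_ FN) (≡-dec (_≟_ FL) (≡-dec _≟AB_ (_≟_ FN)))

  _≟₂_ : DecidableEquality (G₂ EN EL)
  _≟₂_ = ≡-dec (_≟_ FN) (≡-dec (_≟_ FL) _≟AB_)

  a b : G₁ EN EL
  a = inj₂ (inj₂ (inj₁ ea))
  b = inj₂ (inj₂ (inj₁ eb))

  orig : EN → G₁ EN EL
  orig x = inj₁ x

  lel : EL → G₁ EN EL
  lel l = inj₂ (inj₁ l)

  copy : EN → G₁ EN EL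
  copy x = inj₂ (inj₂ (inj₂ x))

  -- N ⊕ L (new elements are not yet present and are ignored)
  rSum : RankFn (G₁ EN EL)
  rSum X = rN (λ x → X (orig x)) + rL (λ l → X (lel l))

  EN∪ : EL → Subset (G₁ EN EL)
  EN∪ s (inj₁ _) = true
  EN∪ s (inj₂ (inj₁ l)) = does (_≟_ FL l s)
  EN∪ s (inj₂ (inj₂ _)) = false

  r-a : RankFn (G₁ EN EL)
  r-a = freelyPlace _≟₁_ rSum a (EN∪ p)

  r-ab : RankFn (G₁ EN EL)
  r-ab = freelyPlace _≟₁_ r-a b (EN∪ q)

  step : RankFn (G₁ EN EL) → EN → RankFn (G₁ EN EL)
  step r x = freelyPlace _≟₁_ r (copy x)
               (single _≟₁_ (orig x) ∪ single _≟₁_ (if inA x then a else b))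

  rM₁ : RankFn (G₁ EN EL)
  rM₁ = foldl step r-ab (elems FN)

  -- embedding of M₂'s ground set into M₁'s (relabelled x ↦ x_a / y_b)
  img : Subset (G₂ EN EL) → Subset (G₁ EN EL)
  img X (inj₁ _) = false
  img X (inj₂ (inj₁ l)) = X (inj₂ (inj₁ l))
  img X (inj₂ (inj₂ (inj₁ t))) = X (inj₂ (inj₂ t))
  img X (inj₂ (inj₂ (inj₂ x))) = X (inj₁ x)

  -- M₂(L,p,q;N,A,B): delete A ∪ B from M₁ and relabel
  rM₂ : RankFn (G₂ EN EL)
  rM₂ X = rM₁ (img X)

  ℓ : EL → G₂ EN EL
  ℓ l = inj₂ (inj₁ l)

  A∪a : Subset (G₂ EN EL)
  A∪a (inj₁ x) = inA x
  A∪a (inj₂ (inj₁ _)) = false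
  A∪a (inj₂ (inj₂ ea)) = true
  A∪a (inj₂ (inj₂ eb)) = false

{-# OPTIONS --safe #-}
module Submission where

-- Everything is computed in M₁, reading a subset X of E(M₂) through img. Whatever the order of
-- placement, every copy x_a, y_b is freely placed on its line {x, a} or {y, b} of M₁, so a rank
-- can be computed by peeling off one copy at a time, down to copy-free sets whose rank is an
-- explicit formula in r_N and r_L. If q ∈ cl_L(p), every set spanning p spans q. Otherwise p and q
-- are independent in L. A set Y ⊆ A ∪ B ∪ {a, b} spanning p already spans E(N) ∪ p, so
-- r(Y) ≥ r(N) + 1; if Y contains b or a copy of some y ∈ B, then even r(Y) ≥ r(N) + 2, the rank of
-- E(N) ∪ {p, q} together with all new elements, so Y spans q. Thus Y ⊆ A ∪ {a}, and as |A| = r(N),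
-- reaching rank r(N) + 1 forces Y to contain a and all of A.

open import Defs
open import Data.Bool using (Bool; true; false; not; _∨_; if_then_else_; T)
open import Data.Bool.Properties using (∨-identityʳ; ∨-zeroʳ; ∨-assoc; ∨-comm; ∨-idem; T-∨; T-∧; if-cong)
open import Data.Empty using (⊥-elim)
open import Data.List using (List; []; _∷_; length; filterᵇ; foldl)
open import Data.List.Membership.Propositional using (_∈_)
open import Data.List.Relation.Unary.All as All using (All; []; _∷_)
open import Data.List.Relation.Unary.AllPairs using ([]; _∷_)
open import Data.List.Relation.Unary.Any using (here; there)
open import Data.List.Relation.Unary.Any.Properties using (¬Any[])
open import Data.List.Relation.Unary.Unique.Propositional using (Unique)
import Data.Nat as ℕ
open import Data.Nat using (ℕ; suc; _+_; _≤_; _<_; _⊓_; _≡ᵇ_; z≤n; s≤s; _≤?_)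
open import Data.Nat.Properties hiding (_≟_)
open import Algebra.Properties.CommutativeSemigroup ⊓-commutativeSemigroup using (interchange)
open import Data.Product using (_×_; _,_; proj₁; proj₂)
open import Data.Sum using (_⊎_; inj₁; inj₂)
open import Data.Unit using (tt)
open import Function using (_∘_; _⇔_; Equivalence; mk⇔; case_of_)
open import Relation.Binary.PropositionalEquality
open import Relation.Binary.Definitions using (DecidableEquality)
open import Relation.Nullary using (¬_; yes; no; contradiction)
open import Relation.Nullary.Decidable using (dec-true; dec-false)

true-or-false : ∀ b → b ≡ true ⊎ b ≡ false
true-or-false true = inj₁ refl
true-or-false false = inj₂ refl


if-≡ᵇ≡suc⊓ : ∀ {u v} → u ≤ v → (if v ≡ᵇ u then u else suc u) ≡ suc u ⊓ v
if-≡ᵇ≡suc⊓ {u} {v} u≤v with v ≡ᵇ u in eq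
... | true with refl ← ≡ᵇ⇒≡ v u (subst T (sym eq) tt) = sym (m≥n⇒m⊓n≡n (n≤1+n v))
... | false = sym (m≤n⇒m⊓n≡m (≤∧≢⇒< u≤v λ u≡v → subst T eq (≡⇒≡ᵇ v u (sym u≡v))))

suc⊓-fixed-side : ∀ {u u' v v'} → u ≤ u' → v ≤ v' → suc u ⊓ v ≡ suc u' ⊓ v' →
                           (u' ≡ u × suc u ≤ v) ⊎ (v' ≡ v × v ≤ suc u)
suc⊓-fixed-side {u} {u'} {v} {v'} u≤u' v≤v' eq with suc u ≤? v
... | no su≰v = inj₂ (v'≡v , m≤n⇒m≤1+n v≤u)
  where
    v≤u : v ≤ u
    v≤u = ≤-pred (≰⇒> su≰v)
    v'≡v : v' ≡ v
    v'≡v with m≤n⇒m<n∨m≡n v≤v'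
    ... | inj₂ v≡v' = sym v≡v'
    ... | inj₁ v<v' = contradiction (trans (sym (m≥n⇒m⊓n≡n (m≤n⇒m≤1+n v≤u))) eq)
                                    (<⇒≢ (⊓-glb (s≤s (≤-trans v≤u u≤u')) v<v'))
... | yes su≤v with m≤n⇒m<n∨m≡n u≤u'
...   | inj₂ u≡u' = inj₁ (sym u≡u' , su≤v)
...   | inj₁ u<u' = inj₂ (≤-antisym v'≤v v≤v' , ≤-trans v≤v' (≤-reflexive (sym su≡v')))
  where
    su≡v' : suc u ≡ v'
    su≡v' with ⊓-sel (suc u') v'
    ... | inj₁ min≡su' = contradiction (trans (trans (sym (m≤n⇒m⊓n≡m su≤v)) eq) min≡su')
                                       (<⇒≢ (s≤s u<u'))
    ... | inj₂ min≡v' = trans (trans (sym (m≤n⇒m⊓n≡m su≤v)) eq) min≡v'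
    v'≤v : v' ≤ v
    v'≤v = subst (_≤ v) su≡v' su≤v

suc⊓-≤-via-fixed-side : ∀ {u u' v v' U V} → u ≤ u' → v ≤ v' → suc u ⊓ v ≡ suc u' ⊓ v' →
                      (u' ≡ u → U ≡ u) → (v' ≡ v → V ≡ v) → suc U ⊓ V ≤ suc u ⊓ v
suc⊓-≤-via-fixed-side {u} {v = v} u≤u' v≤v' eq U≡u V≡v with suc⊓-fixed-side u≤u' v≤v' eq
... | inj₁ (u'≡u , su≤v) rewrite U≡u u'≡u | m≤n⇒m⊓n≡m su≤v = m⊓n≤m (suc u) _
... | inj₂ (v'≡v , v≤su) rewrite V≡v v'≡v | m≥n⇒m⊓n≡n v≤su = m⊓n≤n _ v

module SubsetProperties {G : Set} (_≟_ : DecidableEquality G) where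

  infix 4 _≈_
  _≈_ : Subset G → Subset G → Set
  X ≈ Y = ∀ g → X g ≡ Y g

  infixl 8 _∖_
  _∖_ : Subset G → G → Subset G
  _∖_ = remove _≟_

  ⁅_⁆ : G → Subset G
  ⁅_⁆ = single _≟_

  Ext : RankFn G → Set
  Ext r = ∀ X Y → X ≈ Y → r X ≡ r Y

  Mono : RankFn G → Set
  Mono r = ∀ X Y → X ⊆ Y → r X ≤ r Y

  ≈-refl : ∀ {X} → X ≈ X
  ≈-refl _ = refl

  ≈-trans : ∀ {X Y Z} → X ≈ Y → Y ≈ Z → X ≈ Z
  ≈-trans X≈Y Y≈Z g = trans (X≈Y g) (Y≈Z g)

  ∪-cong : ∀ {X X' Y Y'} → X ≈ X' → Y ≈ Y' → X ∪ Y ≈ X' ∪ Y'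
  ∪-cong X≈X' Y≈Y' g = cong₂ _∨_ (X≈X' g) (Y≈Y' g)

  ∪-swapʳ : ∀ W X Y → (W ∪ X) ∪ Y ≈ (W ∪ Y) ∪ X
  ∪-swapʳ W X Y g = begin
    (W g ∨ X g) ∨ Y g ≡⟨ ∨-assoc (W g) (X g) (Y g) ⟩
    W g ∨ (X g ∨ Y g) ≡⟨ cong (W g ∨_) (∨-comm (X g) (Y g)) ⟩
    W g ∨ (Y g ∨ X g) ≡⟨ ∨-assoc (W g) (Y g) (X g) ⟨
    (W g ∨ Y g) ∨ X g ∎
    where open ≡-Reasoning

  ∪-idemʳ : ∀ X Y → (X ∪ Y) ∪ Y ≈ X ∪ Y
  ∪-idemʳ X Y g = trans (∨-assoc (X g) (Y g) (Y g)) (cong (X g ∨_) (∨-idem (Y g)))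

  ∪-⁅⁆-self : ∀ X e → (X ∪ ⁅ e ⁆) e ≡ true
  ∪-⁅⁆-self X e = trans (cong (X e ∨_) (dec-true (e ≟ e) refl)) (∨-zeroʳ (X e))

  ∪-absorbʳ : ∀ {X Y} → Y ⊆ X → X ∪ Y ≈ X
  ∪-absorbʳ {X} {Y} Y⊆X g with X g in Xg | Y g in Yg
  ... | true  | _     = refl
  ... | false | false = refl
  ... | false | true  = ⊥-elim (subst T Xg (Y⊆X g (subst T (sym Yg) tt)))

  ∪-lub : ∀ {X Y Z : Subset G} → X ⊆ Z → Y ⊆ Z → (X ∪ Y) ⊆ Z
  ∪-lub {X} X⊆Z Y⊆Z g t with Equivalence.to (T-∨ {X g}) t
  ... | inj₁ tx = X⊆Z g tx
  ... | inj₂ ty = Y⊆Z g ty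

  ⁅⁆-⊆ : ∀ {X e} → X e ≡ true → ⁅ e ⁆ ⊆ X
  ⁅⁆-⊆ {e = e} Xe g t with g ≟ e
  ... | yes refl = subst T (sym Xe) tt

  ∖-self : ∀ X e → (X ∖ e) e ≡ false
  ∖-self X e rewrite dec-true (e ≟ e) refl = refl

  ∖-other : ∀ X {e g} → g ≢ e → (X ∖ e) g ≡ X g
  ∖-other X {e} {g} g≢e rewrite dec-false (g ≟ e) g≢e = refl

  ∖-cong : ∀ {X Y} e → X ≈ Y → X ∖ e ≈ Y ∖ e
  ∖-cong e X≈Y g with g ≟ e
  ... | yes _ = refl
  ... | no _ = X≈Y g

  ∖-comm : ∀ X e e' → X ∖ e ∖ e' ≈ X ∖ e' ∖ e
  ∖-comm X e e' g with g ≟ e | g ≟ e'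
  ... | yes _ | yes _ = refl
  ... | yes _ | no _ = refl
  ... | no _ | yes _ = refl
  ... | no _ | no _ = refl

  ∪-∖ : ∀ X S {e} → S e ≡ false → (X ∪ S) ∖ e ≈ X ∖ e ∪ S
  ∪-∖ X S {e} Se≡false g with g ≟ e
  ... | yes refl = sym Se≡false
  ... | no _ = refl

  ⊆-∪ˡ : ∀ (X Y : Subset G) → X ⊆ (X ∪ Y)
  ⊆-∪ˡ X Y g = Equivalence.from T-∨ ∘ inj₁

  ⊆-∪ʳ : ∀ (X Y : Subset G) → Y ⊆ (X ∪ Y)
  ⊆-∪ʳ X Y g = Equivalence.from (T-∨ {X g}) ∘ inj₂

  ∪-mono-⊆ : ∀ {X X' Y Y' : Subset G} → X ⊆ X' → Y ⊆ Y' → (X ∪ Y) ⊆ (X' ∪ Y')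
  ∪-mono-⊆ {X} {X'} {Y} {Y'} X⊆X' Y⊆Y' g t with Equivalence.to (T-∨ {X g}) t
  ... | inj₁ tx = ⊆-∪ˡ X' Y' g (X⊆X' g tx)
  ... | inj₂ ty = ⊆-∪ʳ X' Y' g (Y⊆Y' g ty)

  ∖-⊆ : ∀ X e → (X ∖ e) ⊆ X
  ∖-⊆ X e g t with g ≟ e
  ... | no _ = t

  ∖-mono-⊆ : ∀ {X Y} e → X ⊆ Y → (X ∖ e) ⊆ (Y ∖ e)
  ∖-mono-⊆ e X⊆Y g t with g ≟ e
  ... | no _ = X⊆Y g t

  ⊆-∖ : ∀ {X Y e} → X e ≡ false → X ⊆ Y → X ⊆ (Y ∖ e)
  ⊆-∖ {e = e} Xe≡false X⊆Y g t with g ≟ e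
  ... | yes refl = ⊥-elim (subst T Xe≡false t)
  ... | no _ = X⊆Y g t

module PrincipalExtension {G : Set} (_≟_ : DecidableEquality G) where
  open SubsetProperties _≟_

  freelyPlace-∌ : ∀ r e S {Z} → Z e ≡ false → freelyPlace _≟_ r e S Z ≡ r Z
  freelyPlace-∌ r e S Ze≡false = if-cong Ze≡false

  freelyPlace-∋ : ∀ {r} e S {Z} → Mono r → Z e ≡ true →
                  freelyPlace _≟_ r e S Z ≡ suc (r (Z ∖ e)) ⊓ r (Z ∖ e ∪ S)
  freelyPlace-∋ e S {Z} mono Ze≡true =
    trans (if-cong Ze≡true) (if-≡ᵇ≡suc⊓ (mono _ _ (⊆-∪ˡ (Z ∖ e) S)))

  freelyPlace-mono : ∀ {r} e S → Mono r → Mono (freelyPlace _≟_ r e S)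
  freelyPlace-mono {r} e S mono X Y X⊆Y with true-or-false (X e) | true-or-false (Y e)
  ... | inj₁ Xe | inj₁ Ye =
        subst₂ _≤_ (sym (freelyPlace-∋ e S mono Xe)) (sym (freelyPlace-∋ e S mono Ye))
        (⊓-mono-≤ (s≤s (mono _ _ (∖-mono-⊆ e X⊆Y))) (mono _ _ (∪-mono-⊆ (∖-mono-⊆ e X⊆Y) (λ _ t → t))))
  ... | inj₁ Xe | inj₂ Ye = ⊥-elim (subst T Ye (X⊆Y e (subst T (sym Xe) tt)))
  ... | inj₂ Xe | inj₁ Ye =
        subst₂ _≤_ (sym (freelyPlace-∌ r e S Xe)) (sym (freelyPlace-∋ e S mono Ye))
        (⊓-glb (m≤n⇒m≤1+n (mono _ _ X⊆Y∖e)) (mono _ _ (λ g → ⊆-∪ˡ (Y ∖ e) S g ∘ X⊆Y∖e g)))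
    where X⊆Y∖e = ⊆-∖ Xe X⊆Y
  ... | inj₂ Xe | inj₂ Ye =
        subst₂ _≤_ (sym (freelyPlace-∌ r e S Xe)) (sym (freelyPlace-∌ r e S Ye)) (mono X Y X⊆Y)

  freelyPlace-ext : ∀ {r} e S → Mono r → Ext r → Ext (freelyPlace _≟_ r e S)
  freelyPlace-ext {r} e S mono ext X Y X≈Y with true-or-false (X e)
  ... | inj₁ Xe = begin
    freelyPlace _≟_ r e S X           ≡⟨ freelyPlace-∋ e S mono Xe ⟩
    suc (r (X ∖ e)) ⊓ r (X ∖ e ∪ S)   ≡⟨ cong₂ (λ x y → suc x ⊓ y) (ext _ _ X∖e≈Y∖e)
                                                                   (ext _ _ (∪-cong X∖e≈Y∖e ≈-refl)) ⟩
    suc (r (Y ∖ e)) ⊓ r (Y ∖ e ∪ S)   ≡⟨ freelyPlace-∋ e S mono (trans (sym (X≈Y e)) Xe) ⟨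
    freelyPlace _≟_ r e S Y           ∎
    where
      open ≡-Reasoning
      X∖e≈Y∖e = ∖-cong e X≈Y
  ... | inj₂ Xe = trans (freelyPlace-∌ r e S Xe)
                  (trans (ext X Y X≈Y) (sym (freelyPlace-∌ r e S (trans (sym (X≈Y e)) Xe))))

  FreelyPlacedIn : RankFn G → G → Subset G → Set
  FreelyPlacedIn r e S = ∀ Z → Z e ≡ true → r Z ≡ suc (r (Z ∖ e)) ⊓ r (Z ∖ e ∪ S)

  freelyPlace-freelyPlacedIn : ∀ {r} e S → Mono r → S e ≡ false →
                               FreelyPlacedIn (freelyPlace _≟_ r e S) e S
  freelyPlace-freelyPlacedIn {r} e S mono Se≡false Z Ze≡true =
    trans (freelyPlace-∋ e S mono Ze≡true)
    (cong₂ (λ x y → suc x ⊓ y) (sym (freelyPlace-∌ r e S (∖-self Z e)))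
                               (sym (freelyPlace-∌ r e S (cong₂ _∨_ (∖-self Z e) Se≡false))))

  -- With W = Z ∖ e ∖ e', both orders of placement give
  -- r Z = min(2 + r W, 1 + r(W ∪ S), 1 + r(W ∪ S'), r(W ∪ S ∪ S')).
  freelyPlace-preserves-freelyPlacedIn :
    ∀ {r e S} e' S' → Mono r → Ext r → FreelyPlacedIn r e S → e' ≢ e → S e' ≡ false → S' e ≡ false →
    FreelyPlacedIn (freelyPlace _≟_ r e' S') e S
  freelyPlace-preserves-freelyPlacedIn {r} {e} {S} e' S' mono ext free e'≢e Se'≡false S'e≡false Z Ze≡true
    with true-or-false (Z e')
  ... | inj₂ Ze' = begin
    r' Z                                 ≡⟨ freelyPlace-∌ r e' S' Ze' ⟩
    r Z                                  ≡⟨ free Z Ze≡true ⟩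
    suc (r (Z ∖ e)) ⊓ r (Z ∖ e ∪ S)      ≡⟨ cong₂ (λ x y → suc x ⊓ y) (freelyPlace-∌ r e' S' Z∖e∌e')
                                             (freelyPlace-∌ r e' S' (cong₂ _∨_ Z∖e∌e' Se'≡false)) ⟨
    suc (r' (Z ∖ e)) ⊓ r' (Z ∖ e ∪ S)    ∎
    where
      open ≡-Reasoning
      r' = freelyPlace _≟_ r e' S'
      Z∖e∌e' : (Z ∖ e) e' ≡ false
      Z∖e∌e' = trans (∖-other Z e'≢e) Ze'
  ... | inj₁ Ze' = begin
    r' Z                                         ≡⟨ placed' Ze' ≈-refl ⟩
    suc (r (Z ∖ e')) ⊓ r (Z ∖ e' ∪ S')           ≡⟨ cong₂ (λ x y → suc x ⊓ y) r[Z∖e'] r[Z∖e'∪S'] ⟩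
    suc (suc u ⊓ v) ⊓ (suc v' ⊓ w)               ≡⟨ interchange (suc (suc u)) (suc v) (suc v') w ⟩
    suc (suc u ⊓ v') ⊓ (suc v ⊓ w)               ≡⟨ cong₂ (λ x y → suc x ⊓ y) r'[Z∖e] r'[Z∖e∪S] ⟨
    suc (r' (Z ∖ e)) ⊓ r' (Z ∖ e ∪ S)            ∎
    where
      open ≡-Reasoning
      r' = freelyPlace _≟_ r e' S'
      W = Z ∖ e ∖ e'
      u = r W
      v = r (W ∪ S)
      v' = r (W ∪ S')
      w = r ((W ∪ S) ∪ S')
      placed : ∀ {Y A} → Y e ≡ true → Y ∖ e ≈ A → r Y ≡ suc (r A) ⊓ r (A ∪ S)
      placed {Y} Ye Y∖e≈A = trans (free Y Ye)
        (cong₂ (λ x y → suc x ⊓ y) (ext _ _ Y∖e≈A) (ext _ _ (∪-cong Y∖e≈A ≈-refl)))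
      placed' : ∀ {Y A} → Y e' ≡ true → Y ∖ e' ≈ A → r' Y ≡ suc (r A) ⊓ r (A ∪ S')
      placed' {Y} Ye' Y∖e'≈A = trans (freelyPlace-∋ e' S' mono Ye')
        (cong₂ (λ x y → suc x ⊓ y) (ext _ _ Y∖e'≈A) (ext _ _ (∪-cong Y∖e'≈A ≈-refl)))
      Z∖e'∋e : (Z ∖ e') e ≡ true
      Z∖e'∋e = trans (∖-other Z (e'≢e ∘ sym)) Ze≡true
      Z∖e∋e' : (Z ∖ e) e' ≡ true
      Z∖e∋e' = trans (∖-other Z e'≢e) Ze'
      r[Z∖e'] : r (Z ∖ e') ≡ suc u ⊓ v
      r[Z∖e'] = placed Z∖e'∋e (∖-comm Z e' e)
      r[Z∖e'∪S'] : r (Z ∖ e' ∪ S') ≡ suc v' ⊓ w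
      r[Z∖e'∪S'] = trans (placed (cong (_∨ S' e) Z∖e'∋e)
                                 (≈-trans (∪-∖ (Z ∖ e') S' S'e≡false) (∪-cong (∖-comm Z e' e) ≈-refl)))
                         (cong (suc v' ⊓_) (ext _ _ (∪-swapʳ W S' S)))
      r'[Z∖e] : r' (Z ∖ e) ≡ suc u ⊓ v'
      r'[Z∖e] = placed' Z∖e∋e' ≈-refl
      r'[Z∖e∪S] : r' (Z ∖ e ∪ S) ≡ suc v ⊓ w
      r'[Z∖e∪S] = placed' (cong (_∨ S e') Z∖e∋e') (∪-∖ (Z ∖ e) S Se'≡false)

module Counting {A : Set} (_≟_ : DecidableEquality A) where
  open SubsetProperties _≟_

  length-filterᵇ-mono : ∀ {X Y : Subset A} xs → X ⊆ Y → length (filterᵇ X xs) ≤ length (filterᵇ Y xs)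
  length-filterᵇ-mono [] _ = z≤n
  length-filterᵇ-mono {X} {Y} (y ∷ ys) X⊆Y with X y in Xy | Y y in Yy
  ... | true  | true  = s≤s (length-filterᵇ-mono ys X⊆Y)
  ... | true  | false = ⊥-elim (subst T Yy (X⊆Y y (subst T (sym Xy) tt)))
  ... | false | true  = m≤n⇒m≤1+n (length-filterᵇ-mono ys X⊆Y)
  ... | false | false = length-filterᵇ-mono ys X⊆Y

  length-filterᵇ-∖ : ∀ X {x} xs → X x ≡ true → x ∈ xs →
                     length (filterᵇ (X ∖ x) xs) < length (filterᵇ X xs)
  length-filterᵇ-∖ X (y ∷ ys) Xy (here refl) rewrite ∖-self X y | Xy =
    s≤s (length-filterᵇ-mono ys (∖-⊆ X y))
  length-filterᵇ-∖ X {x} (y ∷ ys) Xx (there x∈ys) with y ≟ x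
  ... | yes refl rewrite Xx = s≤s (length-filterᵇ-mono ys (∖-⊆ X y))
  ... | no _ with X y
  ...   | true  = s≤s (length-filterᵇ-∖ X ys Xx x∈ys)
  ...   | false = length-filterᵇ-∖ X ys Xx x∈ys

  length-filterᵇ-none : ∀ {X : Subset A} xs → All (λ e → X e ≡ false) xs → length (filterᵇ X xs) ≡ 0
  length-filterᵇ-none [] [] = refl
  length-filterᵇ-none (y ∷ ys) (Xy ∷ Xys) rewrite Xy = length-filterᵇ-none ys Xys

  length-filterᵇ-⁅⁆ : ∀ x {xs} → Unique xs → length (filterᵇ ⁅ x ⁆ xs) ≤ 1
  length-filterᵇ-⁅⁆ x [] = z≤n
  length-filterᵇ-⁅⁆ x {y ∷ ys} (y≢ys ∷ unique-ys) with y ≟ x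
  ... | yes refl = s≤s (≤-reflexive (length-filterᵇ-none ys (All.map y∉⁅y⁆ y≢ys)))
    where
      y∉⁅y⁆ : ∀ {e} → y ≢ e → ⁅ y ⁆ e ≡ false
      y∉⁅y⁆ {e} y≢e = dec-false (e ≟ y) (y≢e ∘ sym)
  ... | no _ = length-filterᵇ-⁅⁆ x unique-ys

module MatroidProperties {E : Set} {F : FinSet E} {r : RankFn E} (M : IsMatroid F r) where
  open IsMatroid M
  open SubsetProperties (_≟_ F)
  open Counting (_≟_ F)

  r-empty : ∀ {X} → (∀ e → X e ≡ false) → r X ≡ 0
  r-empty X≡∅ = n≤0⇒n≡0 (subst (_ ≤_) (length-filterᵇ-none (elems F) (All.universal X≡∅ _)) (r-bound _))

  r-⁅⁆≤1 : ∀ e → r ⁅ e ⁆ ≤ 1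
  r-⁅⁆≤1 e = ≤-trans (r-bound ⁅ e ⁆) (length-filterᵇ-⁅⁆ e (unique F))

  spans-⊆ : ∀ {X Y} S → X ⊆ Y → Spans r X S → Spans r Y S
  spans-⊆ {X} {Y} S X⊆Y X-spans-S = ≤-antisym (begin
      r (Y ∪ S)          ≤⟨ r-mono _ _ (∪-mono-⊆ (λ _ t → t) (⊆-∪ʳ X S)) ⟩
      r (Y ∪ (X ∪ S))    ≤⟨ +-cancelʳ-≤ (r (Y ∩ (X ∪ S))) _ _ submodular ⟩
      r Y                ∎)
    (r-mono _ _ (⊆-∪ˡ Y S))
    where
      open ≤-Reasoning
      X⊆Y∩[X∪S] : X ⊆ (Y ∩ (X ∪ S))
      X⊆Y∩[X∪S] g t = Equivalence.from T-∧ (X⊆Y g t , ⊆-∪ˡ X S g t)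
      submodular : r (Y ∪ (X ∪ S)) + r (Y ∩ (X ∪ S)) ≤ r Y + r (Y ∩ (X ∪ S))
      submodular = begin
        r (Y ∪ (X ∪ S)) + r (Y ∩ (X ∪ S))  ≤⟨ r-submod Y (X ∪ S) ⟩
        r Y + r (X ∪ S)                    ≡⟨ cong (r Y +_) X-spans-S ⟩
        r Y + r X                          ≤⟨ +-monoʳ-≤ (r Y) (r-mono _ _ X⊆Y∩[X∪S]) ⟩
        r Y + r (Y ∩ (X ∪ S))              ∎

  independent-pair : ∀ {e f} → r ⁅ e ⁆ ≢ 0 → r (⁅ e ⁆ ∪ ⁅ f ⁆) ≢ r ⁅ e ⁆ →
                     r ⁅ e ⁆ ≡ 1 × r ⁅ f ⁆ ≡ 1 × r (⁅ e ⁆ ∪ ⁅ f ⁆) ≡ 2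
  independent-pair {e} {f} e-nonloop f∉cl[e] = re≡1 , rf≡1 , ref≡2
    where
      re≡1 : r ⁅ e ⁆ ≡ 1
      re≡1 = ≤-antisym (r-⁅⁆≤1 e) (n≢0⇒n>0 e-nonloop)
      ref≤re+rf : r (⁅ e ⁆ ∪ ⁅ f ⁆) ≤ r ⁅ e ⁆ + r ⁅ f ⁆
      ref≤re+rf = ≤-trans (m≤m+n _ _) (r-submod ⁅ e ⁆ ⁅ f ⁆)
      2≤ref : 2 ≤ r (⁅ e ⁆ ∪ ⁅ f ⁆)
      2≤ref = ≤∧≢⇒< (subst (_≤ r (⁅ e ⁆ ∪ ⁅ f ⁆)) re≡1 (r-mono _ _ (⊆-∪ˡ ⁅ e ⁆ ⁅ f ⁆)))
                    (λ 1≡ref → f∉cl[e] (trans (sym 1≡ref) (sym re≡1)))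
      rf≡1 : r ⁅ f ⁆ ≡ 1
      rf≡1 = ≤-antisym (r-⁅⁆≤1 f) (+-cancelˡ-≤ 1 1 (r ⁅ f ⁆)
               (≤-trans 2≤ref (subst (λ k → r (⁅ e ⁆ ∪ ⁅ f ⁆) ≤ k + r ⁅ f ⁆) re≡1 ref≤re+rf)))
      ref≡2 : r (⁅ e ⁆ ∪ ⁅ f ⁆) ≡ 2
      ref≡2 = ≤-antisym (subst₂ (λ i j → r (⁅ e ⁆ ∪ ⁅ f ⁆) ≤ i + j) re≡1 rf≡1 ref≤re+rf) 2≤ref

module ConstructionProperties {EN EL : Set} (FN : FinSet EN) (FL : FinSet EL)
                              (rN : RankFn EN) (rL : RankFn EL)
                              (mN : IsMatroid FN rN) (mL : IsMatroid FL rL)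
                              (inA : Subset EN) (p q : EL) where
  open Construction FN FL rN rL inA p q
  open SubsetProperties _≟₁_
  open PrincipalExtension _≟₁_
  open IsMatroid

  G : Set
  G = G₁ EN EL

  line : EN → Subset G
  line x = ⁅ orig x ⁆ ∪ ⁅ if inA x then a else b ⁆

  line-copy : ∀ x y → line x (copy y) ≡ false
  line-copy x y with inA x
  ... | true = refl
  ... | false = refl

  line-lel : ∀ x l → line x (lel l) ≡ false
  line-lel x l with inA x
  ... | true = refl
  ... | false = refl

  rSum-mono : Mono rSum
  rSum-mono X Y X⊆Y = +-mono-≤ (r-mono mN _ _ (X⊆Y ∘ orig)) (r-mono mL _ _ (X⊆Y ∘ lel))

  rSum-ext : Ext rSum
  rSum-ext X Y X≈Y = cong₂ _+_ (r-ext mN _ _ (X≈Y ∘ orig)) (r-ext mL _ _ (X≈Y ∘ lel))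

  r-a-mono : Mono r-a
  r-a-mono = freelyPlace-mono a (EN∪ p) rSum-mono

  r-ab-mono : Mono r-ab
  r-ab-mono = freelyPlace-mono b (EN∪ q) r-a-mono

  r-ab-ext : Ext r-ab
  r-ab-ext = freelyPlace-ext b (EN∪ q) r-a-mono (freelyPlace-ext a (EN∪ p) rSum-mono rSum-ext)

  foldl-step-mono×ext : ∀ xs {r} → Mono r → Ext r → Mono (foldl step r xs) × Ext (foldl step r xs)
  foldl-step-mono×ext [] mono ext = mono , ext
  foldl-step-mono×ext (y ∷ ys) mono ext =
    foldl-step-mono×ext ys (freelyPlace-mono (copy y) (line y) mono)
                           (freelyPlace-ext (copy y) (line y) mono ext)

  foldl-step-freelyPlacedIn : ∀ xs {r} → Mono r → Ext r → ∀ x →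
                              x ∈ xs ⊎ FreelyPlacedIn r (copy x) (line x) →
                              FreelyPlacedIn (foldl step r xs) (copy x) (line x)
  foldl-step-freelyPlacedIn [] _ _ x (inj₂ placed) = placed
  foldl-step-freelyPlacedIn (y ∷ ys) mono ext x placed-later-or-now =
    foldl-step-freelyPlacedIn ys (freelyPlace-mono (copy y) (line y) mono)
                                 (freelyPlace-ext (copy y) (line y) mono ext) x (after-y placed-later-or-now)
    where
      after-y : x ∈ y ∷ ys ⊎ FreelyPlacedIn _ (copy x) (line x) →
                x ∈ ys ⊎ FreelyPlacedIn (step _ y) (copy x) (line x)
      after-y _ with _≟_ FN x y
      after-y _ | yes refl = inj₂ (freelyPlace-freelyPlacedIn (copy x) (line x) mono (line-copy x x))
      after-y (inj₁ (here x≡y)) | no x≢y = contradiction x≡y x≢y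
      after-y (inj₁ (there x∈ys)) | no _ = inj₁ x∈ys
      after-y (inj₂ placed) | no x≢y =
        inj₂ (freelyPlace-preserves-freelyPlacedIn (copy y) (line y) mono ext placed
                (λ { refl → x≢y refl }) (line-copy x y) (line-copy y x))

  CopyFree : Subset G → Set
  CopyFree Z = ∀ y → Z (copy y) ≡ false

  foldl-step-copyFree : ∀ xs r {Z} → CopyFree Z → foldl step r xs Z ≡ r Z
  foldl-step-copyFree [] r _ = refl
  foldl-step-copyFree (y ∷ ys) r {Z} copyFree =
    trans (foldl-step-copyFree ys (step r y) copyFree) (freelyPlace-∌ r (copy y) (line y) (copyFree y))

  rM₁-mono : Mono rM₁
  rM₁-mono = proj₁ (foldl-step-mono×ext (elems FN) r-ab-mono r-ab-ext)

  rM₁-ext : Ext rM₁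
  rM₁-ext = proj₂ (foldl-step-mono×ext (elems FN) r-ab-mono r-ab-ext)

  rM₁-freelyPlacedIn : ∀ x → FreelyPlacedIn rM₁ (copy x) (line x)
  rM₁-freelyPlacedIn x = foldl-step-freelyPlacedIn (elems FN) r-ab-mono r-ab-ext x (inj₁ (complete FN x))

  rM₁-copyFree : ∀ {Z} → CopyFree Z → rM₁ Z ≡ r-ab Z
  rM₁-copyFree = foldl-step-copyFree (elems FN) r-ab

  peel-copy : ∀ {Z} Y x → Z (copy x) ≡ true → Y (copy x) ≡ false →
              rM₁ (Z ∪ Y) ≡ suc (rM₁ (Z ∖ copy x ∪ Y)) ⊓ rM₁ ((Z ∖ copy x ∪ line x) ∪ Y)
  peel-copy {Z} Y x Zx Yx = trans (rM₁-freelyPlacedIn x (Z ∪ Y) (cong (_∨ Y (copy x)) Zx))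
    (cong₂ (λ u v → suc u ⊓ v) (rM₁-ext _ _ [Z∪Y]∖x≈Z∖x∪Y)
       (rM₁-ext _ _ (≈-trans (∪-cong [Z∪Y]∖x≈Z∖x∪Y ≈-refl) (∪-swapʳ (Z ∖ copy x) Y (line x)))))
    where
      [Z∪Y]∖x≈Z∖x∪Y : (Z ∪ Y) ∖ copy x ≈ Z ∖ copy x ∪ Y
      [Z∪Y]∖x≈Z∖x∪Y = ∪-∖ Z Y Yx

  copy-induction : (P : Subset G → Set) → (∀ Z → CopyFree Z → P Z) →
                   (∀ Z x → Z (copy x) ≡ true → P (Z ∖ copy x) → P (Z ∖ copy x ∪ line x) → P Z) →
                   ∀ Z → P Z
  copy-induction P base peel Z = go (elems FN) Z (λ y _ → complete FN y)
    where
      CopiesIn : List EN → Subset G → Set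
      CopiesIn xs Z = ∀ y → T (Z (copy y)) → y ∈ xs

      drop : ∀ {x xs Z} → CopiesIn (x ∷ xs) Z → Z (copy x) ≡ false → CopiesIn xs Z
      drop copies∈x∷xs Zx y Zy with copies∈x∷xs y Zy
      ... | here refl = ⊥-elim (subst T Zx Zy)
      ... | there y∈xs = y∈xs

      go : ∀ xs Z → CopiesIn xs Z → P Z
      go [] Z copies∈[] = base Z copyFree
        where
          copyFree : CopyFree Z
          copyFree y with Z (copy y) in Zy
          ... | false = refl
          ... | true = ⊥-elim (¬Any[] (copies∈[] y (subst T (sym Zy) tt)))
      go (x ∷ xs) Z copies∈x∷xs with true-or-false (Z (copy x))
      ... | inj₂ Zx = go xs Z (drop {Z = Z} copies∈x∷xs Zx)
      ... | inj₁ Zx = peel Z x Zx (go xs _ copies∈xs) (go xs _ (λ y → copies∈xs y ∘ subst T ([Z∖x∪line]≈Z∖x y)))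
        where
          copies∈xs : CopiesIn xs (Z ∖ copy x)
          copies∈xs = drop {Z = Z ∖ copy x} (λ y → copies∈x∷xs y ∘ ∖-⊆ Z (copy x) (copy y))
                                            (∖-self Z (copy x))
          [Z∖x∪line]≈Z∖x : ∀ y → (Z ∖ copy x ∪ line x) (copy y) ≡ (Z ∖ copy x) (copy y)
          [Z∖x∪line]≈Z∖x y = trans (cong (_ ∨_) (line-copy x y)) (∨-identityʳ _)

  NPart : Subset G → Subset EN
  NPart Z x = Z (orig x)

  LPart : Subset G → Subset EL
  LPart Z l = Z (lel l)

  n : ℕ
  n = rN full

  Lp Lq : Subset EL
  Lp = single (_≟_ FL) p
  Lq = single (_≟_ FL) q

  -- r-a Z and r-ab Z in terms of ρ = r_N(Z ∩ E(N)), t = r_L(T) for T = Z ∩ E(L), tp = r_L(T ∪ p),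
  -- tq = r_L(T ∪ q), tqp = r_L(T ∪ q ∪ p), α = [a ∈ Z] and β = [b ∈ Z].
  rankA : ℕ → ℕ → ℕ → Bool → ℕ
  rankA ρ t tp α = if α then suc (ρ + t) ⊓ (n + tp) else ρ + t

  rankAB : ℕ → ℕ → ℕ → ℕ → ℕ → Bool → Bool → ℕ
  rankAB ρ t tp tq tqp α β = if β then suc (rankA ρ t tp α) ⊓ rankA n tq tqp α else rankA ρ t tp α

  rN-full : ∀ {W} → (∀ x → W x ≡ true) → rN W ≡ n
  rN-full W≡full = r-ext mN _ full W≡full

  r-a-value : ∀ Z → r-a Z ≡ rankA (rN (NPart Z)) (rL (LPart Z)) (rL (LPart Z ∪ Lp)) (Z a)
  r-a-value Z with true-or-false (Z a)
  ... | inj₁ Za = begin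
    r-a Z                                              ≡⟨ freelyPlace-∋ a (EN∪ p) {Z} rSum-mono Za ⟩
    suc (ρ + t) ⊓ (rN (λ x → Z (orig x) ∨ true) + tp)  ≡⟨ cong (λ k → suc (ρ + t) ⊓ (k + tp)) (rN-full (∨-zeroʳ ∘ NPart Z)) ⟩
    rankA ρ t tp true                                  ≡⟨ cong (rankA ρ t tp) Za ⟨
    rankA ρ t tp (Z a)                                 ∎
    where
      open ≡-Reasoning
      ρ = rN (NPart Z)
      t = rL (LPart Z)
      tp = rL (LPart Z ∪ Lp)
  ... | inj₂ Za = trans (freelyPlace-∌ rSum a (EN∪ p) {Z} Za)
                        (sym (cong (rankA (rN (NPart Z)) (rL (LPart Z)) (rL (LPart Z ∪ Lp))) Za))

  r-ab-value : ∀ Z → r-ab Z ≡ rankAB (rN (NPart Z)) (rL (LPart Z)) (rL (LPart Z ∪ Lp))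
                                     (rL (LPart Z ∪ Lq)) (rL ((LPart Z ∪ Lq) ∪ Lp)) (Z a) (Z b)
  r-ab-value Z with true-or-false (Z b)
  ... | inj₁ Zb = begin
    r-ab Z                                   ≡⟨ freelyPlace-∋ b (EN∪ q) {Z} r-a-mono Zb ⟩
    suc (r-a (Z ∖ b)) ⊓ r-a (Z ∖ b ∪ EN∪ q)  ≡⟨ cong₂ (λ u v → suc u ⊓ v) (r-a-value (Z ∖ b))
                                                                       (r-a-value (Z ∖ b ∪ EN∪ q)) ⟩
    suc (rankA ρ t tp (Z a)) ⊓ rankA (rN (λ x → Z (orig x) ∨ true)) tq tqp (Z a ∨ false)
                                             ≡⟨ cong₂ (λ ρ' α → suc (rankA ρ t tp (Z a)) ⊓ rankA ρ' tq tqp α)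
                                                      (rN-full (∨-zeroʳ ∘ NPart Z)) (∨-identityʳ (Z a)) ⟩
    rankAB ρ t tp tq tqp (Z a) true          ≡⟨ cong (rankAB ρ t tp tq tqp (Z a)) Zb ⟨
    rankAB ρ t tp tq tqp (Z a) (Z b)         ∎
    where
      open ≡-Reasoning
      ρ = rN (NPart Z)
      t = rL (LPart Z)
      tp = rL (LPart Z ∪ Lp)
      tq = rL (LPart Z ∪ Lq)
      tqp = rL ((LPart Z ∪ Lq) ∪ Lp)
  ... | inj₂ Zb = trans (freelyPlace-∌ r-a b (EN∪ q) {Z} Zb) (trans (r-a-value Z) (sym (cong (rankAB-of-Z (Z a)) Zb)))
    where
      rankAB-of-Z : Bool → Bool → ℕ
      rankAB-of-Z = rankAB (rN (NPart Z)) (rL (LPart Z)) (rL (LPart Z ∪ Lp))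
                           (rL (LPart Z ∪ Lq)) (rL ((LPart Z ∪ Lq) ∪ Lp))

  r-ab≡rankAB : ∀ Z {ρ t tp tq tqp α β} → rN (NPart Z) ≡ ρ →
                rL (LPart Z) ≡ t → rL (LPart Z ∪ Lp) ≡ tp → rL (LPart Z ∪ Lq) ≡ tq →
                rL ((LPart Z ∪ Lq) ∪ Lp) ≡ tqp → Z a ≡ α → Z b ≡ β → r-ab Z ≡ rankAB ρ t tp tq tqp α β
  r-ab≡rankAB Z refl refl refl refl refl refl refl = r-ab-value Z

  rM₁-≤-r-ab+copies : ∀ Z → rM₁ Z ≤ r-ab Z + size FN (λ x → Z (copy x))
  rM₁-≤-r-ab+copies = copy-induction P base peel
    where
      open Counting (_≟_ FN)
      P : Subset G → Set
      P Z = rM₁ Z ≤ r-ab Z + size FN (λ x → Z (copy x))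
      base : ∀ Z → CopyFree Z → P Z
      base Z copyFree = ≤-trans (≤-reflexive (rM₁-copyFree copyFree)) (m≤m+n _ _)
      peel : ∀ Z x → Z (copy x) ≡ true → P (Z ∖ copy x) → P (Z ∖ copy x ∪ line x) → P Z
      peel Z x Zx ih _ = begin
        rM₁ Z                                               ≡⟨ rM₁-freelyPlacedIn x Z Zx ⟩
        suc (rM₁ (Z ∖ copy x)) ⊓ rM₁ (Z ∖ copy x ∪ line x)  ≤⟨ m⊓n≤m _ _ ⟩
        suc (rM₁ (Z ∖ copy x))                              ≤⟨ s≤s ih ⟩
        suc (r-ab (Z ∖ copy x) + k)                         ≡⟨ cong (λ i → suc (i + k)) r-ab-ignores-x ⟩
        suc (r-ab Z + k)                                    ≡⟨ +-suc (r-ab Z) k ⟨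
        r-ab Z + suc k                                      ≤⟨ +-monoʳ-≤ (r-ab Z) k<|Z∩copies| ⟩
        r-ab Z + size FN (λ x → Z (copy x))                 ∎
        where
          open ≤-Reasoning
          k = size FN (remove (_≟_ FN) (Z ∘ copy) x)
          k<|Z∩copies| : k < size FN (λ x → Z (copy x))
          k<|Z∩copies| = length-filterᵇ-∖ (Z ∘ copy) (elems FN) Zx (complete FN x)
          r-ab-ignores-x : r-ab (Z ∖ copy x) ≡ r-ab Z
          r-ab-ignores-x = trans (r-ab-value (Z ∖ copy x)) (sym (r-ab-value Z))

  rM₁≡rankAB : ∀ Z {ρ t tp tq tqp α β} → CopyFree Z → rN (NPart Z) ≡ ρ →
               rL (LPart Z) ≡ t → rL (LPart Z ∪ Lp) ≡ tp → rL (LPart Z ∪ Lq) ≡ tq →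
               rL ((LPart Z ∪ Lq) ∪ Lp) ≡ tqp → Z a ≡ α → Z b ≡ β → rM₁ Z ≡ rankAB ρ t tp tq tqp α β
  rM₁≡rankAB Z copyFree ρ t tp tq tqp α β = trans (rM₁-copyFree copyFree) (r-ab≡rankAB Z ρ t tp tq tqp α β)

  rM₁-spans-trans : ∀ {X} S' S → Spans rM₁ X S' → Spans rM₁ (X ∪ S') S → Spans rM₁ X S
  rM₁-spans-trans {X} S' S X-spans-S' X∪S'-spans-S = ≤-antisym (begin
    rM₁ (X ∪ S)          ≤⟨ rM₁-mono _ _ (∪-mono-⊆ (⊆-∪ˡ X S') (λ _ t → t)) ⟩
    rM₁ ((X ∪ S') ∪ S)   ≡⟨ X∪S'-spans-S ⟩
    rM₁ (X ∪ S')         ≡⟨ X-spans-S' ⟩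
    rM₁ X                ∎) (rM₁-mono _ _ (⊆-∪ˡ X S))
    where open ≤-Reasoning

  module SL = SubsetProperties (_≟_ FL)

  rL-≈ : ∀ {U V} → U SL.≈ V → rL U ≡ rL V
  rL-≈ = r-ext mL _ _

  module QInClosureOfP (q∈cl[p] : Spans rL Lp Lq) where
    open MatroidProperties mL using (spans-⊆)

    ∋p⇒spans-q : ∀ Z → Z (lel p) ≡ true → Spans rM₁ Z ⁅ lel q ⁆
    ∋p⇒spans-q = copy-induction P base peel
      where
        P : Subset G → Set
        P Z = Z (lel p) ≡ true → Spans rM₁ Z ⁅ lel q ⁆

        absorbs-q : ∀ {U} → U p ≡ true → rL (U ∪ Lq) ≡ rL U
        absorbs-q {U} Up = spans-⊆ Lq Lp⊆U q∈cl[p]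
          where
            Lp⊆U : Lp ⊆ U
            Lp⊆U l t with _≟_ FL l p
            ... | yes refl = subst T (sym Up) tt

        absorbs-q-under : ∀ {U} V → U p ≡ true → rL ((U ∪ Lq) ∪ V) ≡ rL (U ∪ V)
        absorbs-q-under {U} V Up = trans (rL-≈ (SL.∪-swapʳ U Lq V)) (absorbs-q (cong (_∨ V p) Up))

        base : ∀ Z → CopyFree Z → P Z
        base Z copyFree Zp = trans r[Z∪q] (sym (trans (rM₁-copyFree copyFree) (r-ab-value Z)))
          where
            U = LPart Z
            r[Z∪q] : rM₁ (Z ∪ ⁅ lel q ⁆) ≡
                     rankAB (rN (NPart Z)) (rL U) (rL (U ∪ Lp)) (rL (U ∪ Lq)) (rL ((U ∪ Lq) ∪ Lp)) (Z a) (Z b)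
            r[Z∪q] = rM₁≡rankAB (Z ∪ ⁅ lel q ⁆) (λ y → cong (_∨ false) (copyFree y))
                       (r-ext mN _ _ (∨-identityʳ ∘ NPart Z)) (absorbs-q Zp) (absorbs-q-under Lp Zp)
                       (rL-≈ (SL.∪-idemʳ U Lq)) (rL-≈ (SL.∪-cong (SL.∪-idemʳ U Lq) SL.≈-refl))
                       (∨-identityʳ (Z a)) (∨-identityʳ (Z b))

        peel : ∀ Z x → Z (copy x) ≡ true → P (Z ∖ copy x) → P (Z ∖ copy x ∪ line x) → P Z
        peel Z x Zx ih ih' Zp = begin
          rM₁ (Z ∪ ⁅ lel q ⁆)                                   ≡⟨ peel-copy ⁅ lel q ⁆ x Zx refl ⟩
          suc (rM₁ (Z ∖ copy x ∪ ⁅ lel q ⁆)) ⊓ rM₁ ((Z ∖ copy x ∪ line x) ∪ ⁅ lel q ⁆)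
                                                                ≡⟨ cong₂ (λ u v → suc u ⊓ v) (ih Zp) (ih' (cong (_∨ _) Zp)) ⟩
          suc (rM₁ (Z ∖ copy x)) ⊓ rM₁ (Z ∖ copy x ∪ line x)     ≡⟨ rM₁-freelyPlacedIn x Z Zx ⟨
          rM₁ Z                                                 ∎
          where open ≡-Reasoning

    spans-p⇒spans-q : ∀ {Y} → Spans rM₁ Y ⁅ lel p ⁆ → Spans rM₁ Y ⁅ lel q ⁆
    spans-p⇒spans-q {Y} Y-spans-p =
      rM₁-spans-trans ⁅ lel p ⁆ ⁅ lel q ⁆ Y-spans-p (∋p⇒spans-q _ (∪-⁅⁆-self Y (lel p)))

  AvoidsL : Subset G → Set
  AvoidsL Z = ∀ l → Z (lel l) ≡ false

  module PQIndependent (rp : rL Lp ≡ 1) (rq : rL Lq ≡ 1) (rpq : rL (Lp ∪ Lq) ≡ 2) where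
    open MatroidProperties mL using (r-empty)

    rM₁-L∅ : ∀ Z {ρ α β} → CopyFree Z → AvoidsL Z → rN (NPart Z) ≡ ρ → Z a ≡ α → Z b ≡ β →
              rM₁ Z ≡ rankAB ρ 0 1 1 2 α β
    rM₁-L∅ Z copyFree noL ρ α β = rM₁≡rankAB Z copyFree ρ (r-empty noL)
      (trans (rL-≈ λ l → cong (_∨ Lp l) (noL l)) rp) (trans (rL-≈ λ l → cong (_∨ Lq l) (noL l)) rq)
      (trans (rL-≈ λ l → trans (cong (λ c → (c ∨ Lq l) ∨ Lp l) (noL l)) (∨-comm (Lq l) (Lp l))) rpq) α β

    rM₁-Lp : ∀ Z {ρ α β} → CopyFree Z → LPart Z SL.≈ Lp → rN (NPart Z) ≡ ρ → Z a ≡ α → Z b ≡ β →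
             rM₁ Z ≡ rankAB ρ 1 1 2 2 α β
    rM₁-Lp Z copyFree T≈Lp ρ α β = rM₁≡rankAB Z copyFree ρ (trans (rL-≈ T≈Lp) rp)
      (trans (rL-≈ (SL.≈-trans (SL.∪-cong T≈Lp SL.≈-refl) (∨-idem ∘ Lp))) rp)
      (trans (rL-≈ (SL.∪-cong T≈Lp SL.≈-refl)) rpq)
      (trans (rL-≈ (SL.≈-trans (SL.∪-cong (SL.∪-cong T≈Lp SL.≈-refl) SL.≈-refl)
                               (SL.∪-absorbʳ (SL.⊆-∪ˡ Lp Lq)))) rpq)
      α β

    -- Adding p to a copy-free set without elements of L raises its rank unless it spans E(N).
    rankAB-p-absorbed⇒ρ≡n : ∀ {ρ} α β → ρ ≤ n → rankAB ρ 1 1 2 2 α β ≡ rankAB ρ 0 1 1 2 α β → ρ ≡ n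
    rankAB-p-absorbed⇒ρ≡n {ρ} α β ρ≤n eq with m≤n⇒m<n∨m≡n ρ≤n
    ... | inj₂ ρ≡n = ρ≡n
    ... | inj₁ ρ<n = ⊥-elim (ρ+1≰ρ+0 (ρ+1≤ρ+0 α β eq))
      where
        ρ+1≰ρ+0 : ¬ (ρ + 1 ≤ ρ + 0)
        ρ+1≰ρ+0 h with () ← +-cancelˡ-≤ ρ 1 0 h
        ρ+2≤n+1 : suc (ρ + 1) ≤ n + 1
        ρ+2≤n+1 = +-monoˡ-≤ 1 ρ<n
        ρ+2≤n+2 : suc (ρ + 1) ≤ n + 2
        ρ+2≤n+2 = ≤-trans ρ+2≤n+1 (+-monoʳ-≤ n (s≤s z≤n))
        ρ+3≤n+2 : suc (suc (ρ + 1)) ≤ n + 2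
        ρ+3≤n+2 = subst (suc (suc (ρ + 1)) ≤_) (sym (+-suc n 1)) (s≤s ρ+2≤n+1)
        ρ+1≤ρ+0 : ∀ α β → rankAB ρ 1 1 2 2 α β ≡ rankAB ρ 0 1 1 2 α β → ρ + 1 ≤ ρ + 0
        ρ+1≤ρ+0 false false eq = ≤-reflexive eq
        ρ+1≤ρ+0 true false eq =
          ≤-pred (≤-trans (⊓-glb ≤-refl ρ+2≤n+1) (≤-trans (≤-reflexive eq) (m⊓n≤m _ _)))
        ρ+1≤ρ+0 false true eq =
          ≤-pred (≤-trans (⊓-glb ≤-refl ρ+2≤n+2) (≤-trans (≤-reflexive eq) (m⊓n≤m _ _)))
        ρ+1≤ρ+0 true true eq = ≤-pred (≤-pred (≤-trans
          (⊓-glb (s≤s (⊓-glb ≤-refl ρ+2≤n+1)) (⊓-glb (m≤n⇒m≤1+n ρ+3≤n+2) ρ+3≤n+2))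
          (≤-trans (≤-reflexive eq) (≤-trans (m⊓n≤m _ _) (s≤s (m⊓n≤m _ _))))))

    spans-p⇒spans-N∪p : ∀ Z → AvoidsL Z → Spans rM₁ Z ⁅ lel p ⁆ → Spans rM₁ Z (EN∪ p)
    spans-p⇒spans-N∪p = copy-induction P base peel
      where
        P : Subset G → Set
        P Z = AvoidsL Z → Spans rM₁ Z ⁅ lel p ⁆ → Spans rM₁ Z (EN∪ p)

        base : ∀ Z → CopyFree Z → P Z
        base Z copyFree noL Z-spans-p = begin
          rM₁ (Z ∪ EN∪ p)               ≡⟨ rM₁-Lp (Z ∪ EN∪ p) (copyFree' {EN∪ p} (λ _ → refl))
                                              (λ l → cong (_∨ Lp l) (noL l)) (rN-full (∨-zeroʳ ∘ NPart Z))
                                              (∨-identityʳ (Z a)) (∨-identityʳ (Z b)) ⟩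
          rankAB n 1 1 2 2 (Z a) (Z b)  ≡⟨ cong (λ k → rankAB k 1 1 2 2 (Z a) (Z b)) ρ≡n ⟨
          rankAB ρ 1 1 2 2 (Z a) (Z b)  ≡⟨ r[Z∪p] ⟨
          rM₁ (Z ∪ ⁅ lel p ⁆)           ≡⟨ Z-spans-p ⟩
          rM₁ Z                         ∎
          where
            open ≡-Reasoning
            ρ = rN (NPart Z)
            copyFree' : ∀ {S} → (∀ y → S (copy y) ≡ false) → CopyFree (Z ∪ S)
            copyFree' S∌copies y = cong₂ _∨_ (copyFree y) (S∌copies y)
            r[Z∪p] : rM₁ (Z ∪ ⁅ lel p ⁆) ≡ rankAB ρ 1 1 2 2 (Z a) (Z b)
            r[Z∪p] = rM₁-Lp (Z ∪ ⁅ lel p ⁆) (copyFree' {⁅ lel p ⁆} (λ _ → refl))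
                       (λ l → cong (_∨ Lp l) (noL l)) (r-ext mN _ _ (∨-identityʳ ∘ NPart Z))
                       (∨-identityʳ (Z a)) (∨-identityʳ (Z b))
            ρ≡n : ρ ≡ n
            ρ≡n = rankAB-p-absorbed⇒ρ≡n (Z a) (Z b) (r-mono mN _ _ (λ _ _ → tt))
                    (trans (sym r[Z∪p]) (trans Z-spans-p (rM₁-L∅ Z copyFree noL refl refl refl)))

        peel : ∀ Z x → Z (copy x) ≡ true → P (Z ∖ copy x) → P (Z ∖ copy x ∪ line x) → P Z
        peel Z x Zx ih ih' noL Z-spans-p = ≤-antisym (begin
          rM₁ (Z ∪ EN∪ p)                                        ≡⟨ peel-copy (EN∪ p) x Zx refl ⟩
          suc (rM₁ (Z' ∪ EN∪ p)) ⊓ rM₁ ((Z' ∪ line x) ∪ EN∪ p)   ≤⟨ suc⊓-≤-via-fixed-side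
                                                                      (rM₁-mono _ _ (⊆-∪ˡ Z' ⁅ lel p ⁆))
                                                                      (rM₁-mono _ _ (⊆-∪ˡ (Z' ∪ line x) ⁅ lel p ⁆))
                                                                      p-spanned (ih noL) (ih' noL') ⟩
          suc (rM₁ Z') ⊓ rM₁ (Z' ∪ line x)                       ≡⟨ rM₁-freelyPlacedIn x Z Zx ⟨
          rM₁ Z                                                  ∎) (rM₁-mono _ _ (⊆-∪ˡ Z (EN∪ p)))
          where
            open ≤-Reasoning
            Z' = Z ∖ copy x
            noL' : AvoidsL (Z' ∪ line x)
            noL' l = cong₂ _∨_ (noL l) (line-lel x l)
            p-spanned : suc (rM₁ Z') ⊓ rM₁ (Z' ∪ line x) ≡
                        suc (rM₁ (Z' ∪ ⁅ lel p ⁆)) ⊓ rM₁ ((Z' ∪ line x) ∪ ⁅ lel p ⁆)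
            p-spanned = trans (sym (rM₁-freelyPlacedIn x Z Zx))
                              (trans (sym Z-spans-p) (peel-copy ⁅ lel p ⁆ x Zx refl))

    r[N∪p] : rM₁ (EN∪ p) ≡ n + 1
    r[N∪p] = rM₁-Lp (EN∪ p) (λ _ → refl) (λ _ → refl) refl refl refl

    n+2≤r[N∪p∪b] : suc (n + 1) ≤ rM₁ (EN∪ p ∪ ⁅ b ⁆)
    n+2≤r[N∪p∪b] = subst (suc (n + 1) ≤_)
      (sym (rM₁-Lp (EN∪ p ∪ ⁅ b ⁆) (λ _ → refl) (∨-identityʳ ∘ Lp) refl refl refl))
      (⊓-glb ≤-refl (≤-reflexive (sym (+-suc n 1))))

    Npq⁺ : Subset G
    Npq⁺ (inj₁ _) = true
    Npq⁺ (inj₂ (inj₁ l)) = Lp l ∨ Lq l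
    Npq⁺ (inj₂ (inj₂ _)) = true

    Npq∪ab : Subset G
    Npq∪ab (inj₂ (inj₂ (inj₂ _))) = false
    Npq∪ab g = Npq⁺ g

    r[Npq∪ab]≤n+2 : rM₁ Npq∪ab ≤ n + 2
    r[Npq∪ab]≤n+2 = begin
      rM₁ Npq∪ab                               ≡⟨ rM₁≡rankAB Npq∪ab (λ _ → refl) refl refl refl refl tqp≡2 refl refl ⟩
      rankAB n t (rL (U ∪ Lp)) tq 2 true true  ≤⟨ m⊓n≤n _ _ ⟩
      suc (n + tq) ⊓ (n + 2)                   ≤⟨ m⊓n≤n _ _ ⟩
      n + 2                                    ∎
      where
        open ≤-Reasoning
        U = LPart Npq∪ab
        t = rL U
        tq = rL (U ∪ Lq)
        tqp≡2 : rL ((U ∪ Lq) ∪ Lp) ≡ 2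
        tqp≡2 = trans (rL-≈ (SL.≈-trans (SL.∪-cong (SL.∪-idemʳ Lp Lq) SL.≈-refl)
                                        (SL.∪-absorbʳ (SL.⊆-∪ˡ Lp Lq)))) rpq

    ⊆Npq⁺⇒r≤n+2 : ∀ Z → Z ⊆ Npq⁺ → rM₁ Z ≤ n + 2
    ⊆Npq⁺⇒r≤n+2 = copy-induction P base peel
      where
        P : Subset G → Set
        P Z = Z ⊆ Npq⁺ → rM₁ Z ≤ n + 2
        base : ∀ Z → CopyFree Z → P Z
        base Z copyFree Z⊆Npq⁺ = ≤-trans (rM₁-mono Z Npq∪ab Z⊆Npq∪ab) r[Npq∪ab]≤n+2
          where
            Z⊆Npq∪ab : Z ⊆ Npq∪ab
            Z⊆Npq∪ab (inj₂ (inj₂ (inj₂ y))) t = subst T (copyFree y) t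
            Z⊆Npq∪ab (inj₁ x) t = Z⊆Npq⁺ (inj₁ x) t
            Z⊆Npq∪ab (inj₂ (inj₁ l)) t = Z⊆Npq⁺ (lel l) t
            Z⊆Npq∪ab (inj₂ (inj₂ (inj₁ _))) t = tt
        peel : ∀ Z x → Z (copy x) ≡ true → P (Z ∖ copy x) → P (Z ∖ copy x ∪ line x) → P Z
        peel Z x Zx _ ih' Z⊆Npq⁺ = begin
          rM₁ Z                                               ≡⟨ rM₁-freelyPlacedIn x Z Zx ⟩
          suc (rM₁ (Z ∖ copy x)) ⊓ rM₁ (Z ∖ copy x ∪ line x)  ≤⟨ m⊓n≤n _ _ ⟩
          rM₁ (Z ∖ copy x ∪ line x)                           ≤⟨ ih' (∪-lub (λ g → Z⊆Npq⁺ g ∘ ∖-⊆ Z (copy x) g) line⊆Npq⁺) ⟩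
          n + 2                                               ∎
          where
            open ≤-Reasoning
            line⊆Npq⁺ : line x ⊆ Npq⁺
            line⊆Npq⁺ (inj₁ _) _ = tt
            line⊆Npq⁺ (inj₂ (inj₁ l)) t = ⊥-elim (subst T (line-lel x l) t)
            line⊆Npq⁺ (inj₂ (inj₂ _)) _ = tt

    n+2≤r⇒spans-q : ∀ {Y} → AvoidsL Y → Spans rM₁ Y ⁅ lel p ⁆ → suc (n + 1) ≤ rM₁ (Y ∪ EN∪ p) →
                    Spans rM₁ Y ⁅ lel q ⁆
    n+2≤r⇒spans-q {Y} noL Y-spans-p n+2≤r[Y∪N∪p] = ≤-antisym (begin
      rM₁ (Y ∪ ⁅ lel q ⁆)  ≤⟨ ⊆Npq⁺⇒r≤n+2 _ Y∪q⊆Npq⁺ ⟩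
      n + 2                ≡⟨ +-suc n 1 ⟩
      suc (n + 1)          ≤⟨ n+2≤r[Y∪N∪p] ⟩
      rM₁ (Y ∪ EN∪ p)      ≡⟨ spans-p⇒spans-N∪p Y noL Y-spans-p ⟩
      rM₁ Y                ∎) (rM₁-mono _ _ (⊆-∪ˡ Y ⁅ lel q ⁆))
      where
        open ≤-Reasoning
        Y∪q⊆Npq⁺ : (Y ∪ ⁅ lel q ⁆) ⊆ Npq⁺
        Y∪q⊆Npq⁺ (inj₁ _) _ = tt
        Y∪q⊆Npq⁺ (inj₂ (inj₁ l)) t = SL.⊆-∪ʳ Lp Lq l (subst (λ c → T (c ∨ Lq l)) (noL l) t)
        Y∪q⊆Npq⁺ (inj₂ (inj₂ _)) _ = tt

    spans-p∧¬spans-q⇒b∉ : ∀ {Y} → AvoidsL Y → Spans rM₁ Y ⁅ lel p ⁆ → ¬ Spans rM₁ Y ⁅ lel q ⁆ →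
                          Y b ≡ false
    spans-p∧¬spans-q⇒b∉ {Y} noL Y-spans-p Y-¬spans-q with true-or-false (Y b)
    ... | inj₂ Yb = Yb
    ... | inj₁ Yb =
      contradiction (n+2≤r⇒spans-q noL Y-spans-p (≤-trans n+2≤r[N∪p∪b] (rM₁-mono _ _ N∪p∪b⊆))) Y-¬spans-q
      where
        N∪p∪b⊆ : (EN∪ p ∪ ⁅ b ⁆) ⊆ (Y ∪ EN∪ p)
        N∪p∪b⊆ = ∪-lub (⊆-∪ʳ Y (EN∪ p)) (λ g → ⊆-∪ˡ Y (EN∪ p) g ∘ ⁅⁆-⊆ {Y} Yb g)

    spans-p∧¬spans-q⇒B-copies∉ : ∀ {Y} → AvoidsL Y → Spans rM₁ Y ⁅ lel p ⁆ → ¬ Spans rM₁ Y ⁅ lel q ⁆ →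
                                 ∀ y → inA y ≡ false → Y (copy y) ≡ false
    spans-p∧¬spans-q⇒B-copies∉ {Y} noL Y-spans-p Y-¬spans-q y y∈B with true-or-false (Y (copy y))
    ... | inj₂ Yy = Yy
    ... | inj₁ Yy = contradiction (n+2≤r⇒spans-q noL Y-spans-p n+2≤r[Y∪N∪p]) Y-¬spans-q
      where
        Z = Y ∪ EN∪ p
        N∪p⊆Z∖y : EN∪ p ⊆ (Z ∖ copy y)
        N∪p⊆Z∖y = ⊆-∖ refl (⊆-∪ʳ Y (EN∪ p))
        b∈line : line y b ≡ true
        b∈line rewrite y∈B = refl
        N∪p∪b⊆ : (EN∪ p ∪ ⁅ b ⁆) ⊆ (Z ∖ copy y ∪ line y)
        N∪p∪b⊆ = ∪-mono-⊆ N∪p⊆Z∖y (⁅⁆-⊆ b∈line)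
        n+1≤r[Z∖y] : n + 1 ≤ rM₁ (Z ∖ copy y)
        n+1≤r[Z∖y] = subst (_≤ rM₁ (Z ∖ copy y)) r[N∪p] (rM₁-mono _ _ N∪p⊆Z∖y)
        n+2≤r[Y∪N∪p] : suc (n + 1) ≤ rM₁ Z
        n+2≤r[Y∪N∪p] = begin
          suc (n + 1)                                         ≤⟨ ⊓-glb (s≤s n+1≤r[Z∖y]) (≤-trans n+2≤r[N∪p∪b] (rM₁-mono _ _ N∪p∪b⊆)) ⟩
          suc (rM₁ (Z ∖ copy y)) ⊓ rM₁ (Z ∖ copy y ∪ line y)  ≡⟨ rM₁-freelyPlacedIn y Z (cong (_∨ false) Yy) ⟨
          rM₁ Z                                               ∎
          where open ≤-Reasoning

    n+1≤r : ∀ {Y} → AvoidsL Y → Spans rM₁ Y ⁅ lel p ⁆ → n + 1 ≤ rM₁ Y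
    n+1≤r {Y} noL Y-spans-p = begin
      n + 1            ≡⟨ r[N∪p] ⟨
      rM₁ (EN∪ p)      ≤⟨ rM₁-mono _ _ (⊆-∪ʳ Y (EN∪ p)) ⟩
      rM₁ (Y ∪ EN∪ p)  ≡⟨ spans-p⇒spans-N∪p Y noL Y-spans-p ⟩
      rM₁ Y            ∎
      where open ≤-Reasoning

    -- Once Y avoids b and the copies of B, only a and the copies of A can supply the rank n + 1.
    module _ (|A|≡n : size FN inA ≡ n) {Y : Subset G}
             (noN : ∀ x → Y (orig x) ≡ false) (noL : AvoidsL Y) (b∉Y : Y b ≡ false)
             (B∩Y≡∅ : ∀ y → inA y ≡ false → Y (copy y) ≡ false)
             (Y-spans-p : Spans rM₁ Y ⁅ lel p ⁆) where
      open Counting (_≟_ FN)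
      open MatroidProperties mN using () renaming (r-empty to rN-empty)
      module SN = SubsetProperties (_≟_ FN)

      copies⊆A : (λ x → Y (copy x)) ⊆ inA
      copies⊆A x t with inA x in x∈A
      ... | true = tt
      ... | false = subst T (B∩Y≡∅ x x∈A) t

      r-ab≡rankA : r-ab Y ≡ rankA 0 0 (rL (LPart Y ∪ Lp)) (Y a)
      r-ab≡rankA = r-ab≡rankAB Y (rN-empty noN) (r-empty noL) refl refl refl refl b∉Y

      a∈Y : Y a ≡ true
      a∈Y with true-or-false (Y a)
      ... | inj₁ Ya = Ya
      ... | inj₂ Ya = ⊥-elim (m+1+n≰m n (begin
        n + 1                                     ≤⟨ n+1≤r noL Y-spans-p ⟩
        rM₁ Y                                     ≤⟨ rM₁-≤-r-ab+copies Y ⟩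
        r-ab Y + size FN (λ x → Y (copy x))       ≡⟨ cong (_+ size FN (λ x → Y (copy x))) r-ab≡0 ⟩
        size FN (λ x → Y (copy x))                ≤⟨ length-filterᵇ-mono (elems FN) copies⊆A ⟩
        size FN inA                               ≡⟨ |A|≡n ⟩
        n                                         ∎))
        where
          open ≤-Reasoning
          r-ab≡0 : r-ab Y ≡ 0
          r-ab≡0 = trans r-ab≡rankA (cong (rankA 0 0 (rL (LPart Y ∪ Lp))) Ya)

      A⊆Y : ∀ x → inA x ≡ true → Y (copy x) ≡ true
      A⊆Y x x∈A with true-or-false (Y (copy x))
      ... | inj₁ Yx = Yx
      ... | inj₂ Yx = ⊥-elim (m+1+n≰m n (begin
        n + 1                                     ≤⟨ n+1≤r noL Y-spans-p ⟩
        rM₁ Y                                     ≤⟨ rM₁-≤-r-ab+copies Y ⟩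
        r-ab Y + size FN (λ x → Y (copy x))       ≤⟨ +-mono-≤ r-ab≤1 copies≤|A∖x| ⟩
        1 + size FN (remove (_≟_ FN) inA x)       ≤⟨ length-filterᵇ-∖ inA (elems FN) x∈A (complete FN x) ⟩
        size FN inA                               ≡⟨ |A|≡n ⟩
        n                                         ∎))
        where
          open ≤-Reasoning
          copies≤|A∖x| : size FN (λ x → Y (copy x)) ≤ size FN (remove (_≟_ FN) inA x)
          copies≤|A∖x| = length-filterᵇ-mono (elems FN) (SN.⊆-∖ Yx copies⊆A)
          r-ab≤1 : r-ab Y ≤ 1
          r-ab≤1 = subst (_≤ 1) (sym r-ab≡rankA) (rankA-0-0≤1 (Y a))
            where
              rankA-0-0≤1 : ∀ α → rankA 0 0 (rL (LPart Y ∪ Lp)) α ≤ 1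
              rankA-0-0≤1 true = m⊓n≤m 1 _
              rankA-0-0≤1 false = z≤n

    spans-p∧¬spans-q⇒A∪a : size FN inA ≡ n → ∀ X → (∀ l → X (ℓ l) ≡ false) →
                           Spans rM₁ (img X) ⁅ lel p ⁆ → ¬ Spans rM₁ (img X) ⁅ lel q ⁆ →
                           ∀ e → X e ≡ A∪a e
    spans-p∧¬spans-q⇒A∪a |A|≡n X X∩L≡∅ Y-spans-p Y-¬spans-q = X≡A∪a
      where
        b∉Y = spans-p∧¬spans-q⇒b∉ X∩L≡∅ Y-spans-p Y-¬spans-q
        B∩Y≡∅ = spans-p∧¬spans-q⇒B-copies∉ X∩L≡∅ Y-spans-p Y-¬spans-q
        X≡A∪a : ∀ e → X e ≡ A∪a e
        X≡A∪a (inj₁ x) with inA x in x∈A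
        ... | true = A⊆Y |A|≡n (λ _ → refl) X∩L≡∅ b∉Y B∩Y≡∅ Y-spans-p x x∈A
        ... | false = B∩Y≡∅ x x∈A
        X≡A∪a (inj₂ (inj₁ l)) = X∩L≡∅ l
        X≡A∪a (inj₂ (inj₂ ea)) = a∈Y |A|≡n (λ _ → refl) X∩L≡∅ b∉Y B∩Y≡∅ Y-spans-p
        X≡A∪a (inj₂ (inj₂ eb)) = b∉Y

  img-∪-ℓ : ∀ X s → img (X ∪ single _≟₂_ (ℓ s)) ≈ img X ∪ ⁅ lel s ⁆
  img-∪-ℓ X s (inj₁ _) = refl
  img-∪-ℓ X s (inj₂ (inj₁ _)) = refl
  img-∪-ℓ X s (inj₂ (inj₂ (inj₁ _))) = refl
  img-∪-ℓ X s (inj₂ (inj₂ (inj₂ _))) = refl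

  spansElt⇔spans-img : ∀ X s → SpansElt _≟₂_ rM₂ X (ℓ s) ⇔ Spans rM₁ (img X) ⁅ lel s ⁆
  spansElt⇔spans-img X s =
    mk⇔ (trans (sym (rM₁-ext _ _ (img-∪-ℓ X s)))) (trans (rM₁-ext _ _ (img-∪-ℓ X s)))

lemma4p6 : {EN EL : Set} (FN : FinSet EN) (FL : FinSet EL)
           (rN : RankFn EN) (rL : RankFn EL) →
           IsMatroid FN rN → IsMatroid FL rL →
           (inA : Subset EN) →
           IsBasis FN rN inA → IsBasis FN rN (not ∘ inA) →
           (p q : EL) → p ≢ q →
           rL (single (_≟_ FL) p) ≢ 0 →
           (X : Subset (G₂ EN EL)) →
           (∀ l → X (inj₂ (inj₁ l)) ≡ false) →
           SpansElt (Construction._≟₂_ FN FL rN rL inA p q)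
             (Construction.rM₂ FN FL rN rL inA p q) X
             (Construction.ℓ FN FL rN rL inA p q p) →
           ¬ SpansElt (Construction._≟₂_ FN FL rN rL inA p q)
               (Construction.rM₂ FN FL rN rL inA p q) X
               (Construction.ℓ FN FL rN rL inA p q q) →
           ∀ e → X e ≡ Construction.A∪a FN FL rN rL inA p q e
lemma4p6 FN FL rN rL mN mL inA A-basis _ p q _ p-nonloop X X∩L≡∅ X-spans-p X-¬spans-q =
  case rL (Lp ∪ Lq) ℕ.≟ rL Lp of λ where
    (yes q∈cl[p]) → ⊥-elim (img-¬spans-q (QInClosureOfP.spans-p⇒spans-q q∈cl[p] img-spans-p))
    (no q∉cl[p]) → let (rp , rq , rpq) = independent-pair p-nonloop q∉cl[p] in
      PQIndependent.spans-p∧¬spans-q⇒A∪a rp rq rpq |A|≡n X X∩L≡∅ img-spans-p img-¬spans-q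
  where
    open Construction FN FL rN rL inA p q
    open ConstructionProperties FN FL rN rL mN mL inA p q
    open SubsetProperties _≟₁_ using (⁅_⁆)
    open MatroidProperties mL using (independent-pair)
    |A|≡n : size FN inA ≡ n
    |A|≡n = trans (sym (proj₁ A-basis)) (proj₂ A-basis)
    img-spans-p : Spans rM₁ (img X) ⁅ lel p ⁆
    img-spans-p = Equivalence.to (spansElt⇔spans-img X p) X-spans-p
    img-¬spans-q : ¬ Spans rM₁ (img X) ⁅ lel q ⁆
    img-¬spans-q = X-¬spans-q ∘ Equivalence.from (spansElt⇔spans-img X q)
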